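{- Let $A$ be a binary matrix with $R_{\mathbb{R}}(A)=R_{binary}(A)$. If $x_1,\dots,x_t$ are binary column vectors such that $R_{binary}(A|x_i)=R_{binary}(A)$ for $1\le i\le t$, then $R_{\mathbb{R}}(A|x_1,\dots,x_t)=R_{\mathbb{R}}(A)$.
   Context: A binary matrix has entries in $\{0,1\}$. $R_{\mathbb{R}}$ is the usual real rank. $R_{binary}(A)$ of an $n\times m$ binary matrix $A$ is the minimal $k$ with $A=U\cdot V$, $U$ an $n\times k$ and $V$ a $k\times m$ binary matrix, using ordinary arithmetic. $(A|x_1,\dots,x_t)$ denotes $A$ with the columns $x_1,\dots,x_t$ appended. -}

module Defs where

open import Data.Nat using (ℕ; zero; suc; _<_)
import Data.Nat as ℕ
open import Data.Bool using (Bool; true; false)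
open import Data.Fin using (Fin; zero; suc; splitAt)
open import Data.Sum using ([_,_]′)
open import Data.Product using (Σ; ∃; _×_)
open import Data.Rational using (ℚ; 0ℚ; 1ℚ)
import Data.Rational as ℚ
open import Relation.Binary.PropositionalEquality using (_≡_)
open import Relation.Nullary using (¬_)

Mat : Set → ℕ → ℕ → Set
Mat A n m = Fin n → Fin m → A

BinMat : ℕ → ℕ → Set
BinMat = Mat Bool

BinCol : ℕ → Set
BinCol n = Fin n → Bool

sumℕ : ∀ {k} → (Fin k → ℕ) → ℕ
sumℕ {zero}  f = 0
sumℕ {suc k} f = f zero ℕ.+ sumℕ (λ i → f (suc i))

sumℚ : ∀ {k} → (Fin k → ℚ) → ℚ
sumℚ {zero}  f = 0ℚ
sumℚ {suc k} f = f zero ℚ.+ sumℚ (λ i → f (suc i))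

b2ℕ : Bool → ℕ
b2ℕ false = 0
b2ℕ true  = 1

b2ℚ : Bool → ℚ
b2ℚ false = 0ℚ
b2ℚ true  = 1ℚ

_*ℕ_ : ∀ {n k m} → Mat ℕ n k → Mat ℕ k m → Mat ℕ n m
(U *ℕ V) i j = sumℕ (λ l → U i l ℕ.* V l j)

_*ℚ_ : ∀ {n k m} → Mat ℚ n k → Mat ℚ k m → Mat ℚ n m
(U *ℚ V) i j = sumℚ (λ l → U i l ℚ.* V l j)

toℚMat : ∀ {n m} → BinMat n m → Mat ℚ n m
toℚMat A i j = b2ℚ (A i j)

-- A = U·V with U (n×k), V (k×m) binary, computed with ordinary arithmetic.
BinFactor : ∀ {n m} → BinMat n m → ℕ → Set
BinFactor {n} {m} A k =
  Σ (BinMat n k) λ U → Σ (BinMat k m) λ V →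
    ∀ i j → ((λ a b → b2ℕ (U a b)) *ℕ (λ a b → b2ℕ (V a b))) i j ≡ b2ℕ (A i j)

BinRankIs : ∀ {n m} → BinMat n m → ℕ → Set
BinRankIs A r = BinFactor A r × (∀ k → k < r → ¬ BinFactor A k)

ℚFactor : ∀ {n m} → Mat ℚ n m → ℕ → Set
ℚFactor {n} {m} A k =
  Σ (Mat ℚ n k) λ U → Σ (Mat ℚ k m) λ V → ∀ i j → (U *ℚ V) i j ≡ A i j

-- Rank of a rational matrix (= its real rank): minimal inner dimension of a
-- factorization A = U·V (equivalently the usual rank).
RealRankIs : ∀ {n m} → BinMat n m → ℕ → Set
RealRankIs A r = ℚFactor (toℚMat A) r × (∀ k → k < r → ¬ ℚFactor (toℚMat A) k)

appendCols : ∀ {n m t} → BinMat n m → (Fin t → BinCol n) → BinMat n (m ℕ.+ t)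
appendCols {m = m} A xs i j = [ (λ c → A i c) , (λ s → xs s i) ]′ (splitAt m j)

appendCol : ∀ {n m} → BinMat n m → BinCol n → BinMat n (m ℕ.+ 1)
appendCol A x = appendCols A (λ _ → x)

{-# OPTIONS --safe #-}

-- If (A | x) = U′ W′ is a binary factorisation of inner dimension r, then A = U′ W with W the
-- first m columns of W′. As A has rational rank r, W has full row rank, hence a right inverse P,
-- and U′ = A P. So x, a combination of the columns of U′, lies in the column space of A, which is
-- spanned by the columns of U in any rank factorisation A = U V. All the x_i can therefore be
-- added while still factoring through U, and the rank cannot drop below that of A.
-- The right inverse comes from elimination: a matrix with k rows either has a right inverse or
-- factors through fewer than k rows.
module Submission where

open import Defs
open import Data.Nat using (ℕ)
open import Data.Fin using (Fin)

open import Algebra.Bundles using (CommutativeMonoid; Ring)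
open import Data.Bool using (false; true)
open import Data.Empty using (⊥-elim)
open import Data.Fin using (zero; suc; splitAt; _↑ˡ_; _↑ʳ_)
open import Data.Fin.Properties using (splitAt-↑ˡ; splitAt-↑ʳ; all?; ¬∀⟶∃¬)
open import Data.Nat using (zero; suc; _<_; s≤s)
import Data.Nat as ℕ
open import Data.Nat.Properties using (n<1+n)
open import Data.Product using (∃; ∃-syntax; _×_; _,_; proj₁; proj₂)
open import Data.Rational using (ℚ; 0ℚ; 1ℚ; _+_; _*_; -_; _-_; 1/_; NonZero; ≢-nonZero)
open import Data.Rational.Properties
  using ( _≟_; +-identityˡ; +-identityʳ; +-inverseʳ; neg-distrib-+
        ; *-assoc; *-identityˡ; *-identityʳ; *-zeroˡ; *-zeroʳ; *-inverseʳ
        ; *-distribˡ-+; *-distribʳ-+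
        ; +-0-commutativeMonoid; +-0-group; +-*-ring)
open import Data.Sum using (_⊎_; inj₁; inj₂; [_,_]′)
import Data.Sum as Sum
open import Function using (_∘_)
open import Relation.Binary.PropositionalEquality
  using (_≡_; refl; sym; trans; cong; cong₂; module ≡-Reasoning)
open import Relation.Nullary using (¬_; Dec; yes; no)

open import Algebra.Properties.CommutativeSemigroup
  (CommutativeMonoid.commutativeSemigroup +-0-commutativeMonoid) using (interchange)
open import Algebra.Properties.Group +-0-group using (x∙y⁻¹≈ε⇒x≈y)
open import Algebra.Properties.Ring +-*-ring using (x[y-z]≈xy-xz)
open import Algebra.Properties.Semiring.Mult (Ring.semiring +-*-ring)
  using (×-homo-+; ×1-homo-*) renaming (_×_ to _×ℚ_)

open ≡-Reasoning

sumℚ-cong : ∀ {k} {f g : Fin k → ℚ} → (∀ i → f i ≡ g i) → sumℚ f ≡ sumℚ g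
sumℚ-cong {zero}  _   = refl
sumℚ-cong {suc k} f≗g = cong₂ _+_ (f≗g zero) (sumℚ-cong (f≗g ∘ suc))

sumℚ-zero : ∀ k → sumℚ {k} (λ _ → 0ℚ) ≡ 0ℚ
sumℚ-zero zero    = refl
sumℚ-zero (suc k) = trans (+-identityˡ (sumℚ {k} (λ _ → 0ℚ))) (sumℚ-zero k)

sumℚ-+ : ∀ {k} (f g : Fin k → ℚ) → sumℚ (λ i → f i + g i) ≡ sumℚ f + sumℚ g
sumℚ-+ {zero}  f g = refl
sumℚ-+ {suc k} f g =
  trans (cong (f zero + g zero +_) (sumℚ-+ (f ∘ suc) (g ∘ suc)))
        (interchange (f zero) (g zero) (sumℚ (f ∘ suc)) (sumℚ (g ∘ suc)))

sumℚ-neg : ∀ {k} (f : Fin k → ℚ) → sumℚ (λ i → - f i) ≡ - sumℚ f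
sumℚ-neg {zero}  f = refl
sumℚ-neg {suc k} f =
  trans (cong (- f zero +_) (sumℚ-neg (f ∘ suc)))
        (sym (neg-distrib-+ (f zero) (sumℚ (f ∘ suc))))

sumℚ-- : ∀ {k} (f g : Fin k → ℚ) → sumℚ (λ i → f i - g i) ≡ sumℚ f - sumℚ g
sumℚ-- f g = trans (sumℚ-+ f (-_ ∘ g)) (cong (sumℚ f +_) (sumℚ-neg g))

sumℚ-*ˡ : ∀ {k} c (f : Fin k → ℚ) → sumℚ (λ i → c * f i) ≡ c * sumℚ f
sumℚ-*ˡ {zero}  c f = sym (*-zeroʳ c)
sumℚ-*ˡ {suc k} c f =
  trans (cong (c * f zero +_) (sumℚ-*ˡ c (f ∘ suc)))
        (sym (*-distribˡ-+ c (f zero) (sumℚ (f ∘ suc))))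

sumℚ-*ʳ : ∀ {k} c (f : Fin k → ℚ) → sumℚ (λ i → f i * c) ≡ sumℚ f * c
sumℚ-*ʳ {zero}  c f = sym (*-zeroˡ c)
sumℚ-*ʳ {suc k} c f =
  trans (cong (f zero * c +_) (sumℚ-*ʳ c (f ∘ suc)))
        (sym (*-distribʳ-+ c (f zero) (sumℚ (f ∘ suc))))

sumℚ-comm : ∀ {a b} (f : Fin a → Fin b → ℚ) →
  sumℚ (λ i → sumℚ (f i)) ≡ sumℚ (λ j → sumℚ (λ i → f i j))
sumℚ-comm {zero}  {b} f = sym (sumℚ-zero b)
sumℚ-comm {suc a}     f =
  trans (cong (sumℚ (f zero) +_) (sumℚ-comm (f ∘ suc)))
        (sym (sumℚ-+ (f zero) (λ j → sumℚ (λ i → f (suc i) j))))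

infix 7 _·_
_·_ : ∀ {k} → (Fin k → ℚ) → (Fin k → ℚ) → ℚ
x · y = sumℚ (λ l → x l * y l)

·-*ʳ : ∀ {k} (x y : Fin k → ℚ) c → x · (λ l → y l * c) ≡ (x · y) * c
·-*ʳ x y c = trans (sumℚ-cong (λ l → sym (*-assoc (x l) (y l) c))) (sumℚ-*ʳ c (λ l → x l * y l))

1ᴹ : ∀ {k} → Mat ℚ k k
1ᴹ zero    zero    = 1ℚ
1ᴹ zero    (suc _) = 0ℚ
1ᴹ (suc _) zero    = 0ℚ
1ᴹ (suc a) (suc b) = 1ᴹ a b

sumℚ-1ᴹˡ : ∀ {k} (a : Fin k) (f : Fin k → ℚ) → sumℚ (λ l → 1ᴹ a l * f l) ≡ f a
sumℚ-1ᴹˡ zero    f = begin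
  1ℚ * f zero + sumℚ (λ l → 0ℚ * f (suc l))
    ≡⟨ cong₂ _+_ (*-identityˡ (f zero)) (trans (sumℚ-*ˡ 0ℚ (f ∘ suc)) (*-zeroˡ (sumℚ (f ∘ suc)))) ⟩
  f zero + 0ℚ                            ≡⟨ +-identityʳ (f zero) ⟩
  f zero                                 ∎
sumℚ-1ᴹˡ (suc a) f = trans (cong₂ _+_ (*-zeroˡ (f zero)) (sumℚ-1ᴹˡ a (f ∘ suc))) (+-identityˡ _)

sumℚ-1ᴹʳ : ∀ {k} (a : Fin k) (f : Fin k → ℚ) → sumℚ (λ l → f l * 1ᴹ l a) ≡ f a
sumℚ-1ᴹʳ zero    f = begin
  f zero * 1ℚ + sumℚ (λ l → f (suc l) * 0ℚ)
    ≡⟨ cong₂ _+_ (*-identityʳ (f zero)) (trans (sumℚ-*ʳ 0ℚ (f ∘ suc)) (*-zeroʳ (sumℚ (f ∘ suc)))) ⟩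
  f zero + 0ℚ                            ≡⟨ +-identityʳ (f zero) ⟩
  f zero                                 ∎
sumℚ-1ᴹʳ (suc a) f = trans (cong₂ _+_ (*-zeroʳ (f zero)) (sumℚ-1ᴹʳ a (f ∘ suc))) (+-identityˡ _)

infix 4 _≋_
_≋_ : ∀ {n m} → Mat ℚ n m → Mat ℚ n m → Set
M ≋ N = ∀ i j → M i j ≡ N i j

0ᴹ : ∀ {n m} → Mat ℚ n m
0ᴹ _ _ = 0ℚ

infixl 6 _-ᴹ_
_-ᴹ_ : ∀ {n m} → Mat ℚ n m → Mat ℚ n m → Mat ℚ n m
(M -ᴹ N) i j = M i j - N i j

_⊗_ : ∀ {n m} → (Fin n → ℚ) → (Fin m → ℚ) → Mat ℚ n m
(x ⊗ y) i j = x i * y j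

*ℚ-congˡ : ∀ {n k m} (X : Mat ℚ n k) {Y Z : Mat ℚ k m} → Y ≋ Z → X *ℚ Y ≋ X *ℚ Z
*ℚ-congˡ X Y≋Z i j = sumℚ-cong (λ l → cong (X i l *_) (Y≋Z l j))

*ℚ-congʳ : ∀ {n k m} {X Y : Mat ℚ n k} (Z : Mat ℚ k m) → X ≋ Y → X *ℚ Z ≋ Y *ℚ Z
*ℚ-congʳ Z X≋Y i j = sumℚ-cong (λ l → cong (_* Z l j) (X≋Y i l))

*ℚ-assoc : ∀ {n p q m} (X : Mat ℚ n p) (Y : Mat ℚ p q) (Z : Mat ℚ q m) →
  (X *ℚ Y) *ℚ Z ≋ X *ℚ (Y *ℚ Z)
*ℚ-assoc X Y Z i j = begin
  sumℚ (λ l → sumℚ (λ b → X i b * Y b l) * Z l j)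
    ≡⟨ sumℚ-cong (λ l → sym (sumℚ-*ʳ (Z l j) (λ b → X i b * Y b l))) ⟩
  sumℚ (λ l → sumℚ (λ b → X i b * Y b l * Z l j))
    ≡⟨ sumℚ-comm (λ l b → X i b * Y b l * Z l j) ⟩
  sumℚ (λ b → sumℚ (λ l → X i b * Y b l * Z l j))
    ≡⟨ sumℚ-cong (λ b → trans (sumℚ-cong (λ l → *-assoc (X i b) (Y b l) (Z l j)))
                              (sumℚ-*ˡ (X i b) (λ l → Y b l * Z l j))) ⟩
  sumℚ (λ b → X i b * sumℚ (λ l → Y b l * Z l j)) ∎

*ℚ-identityˡ : ∀ {n m} (X : Mat ℚ n m) → 1ᴹ *ℚ X ≋ X
*ℚ-identityˡ X i j = sumℚ-1ᴹˡ i (λ l → X l j)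

*ℚ-identityʳ : ∀ {n m} (X : Mat ℚ n m) → X *ℚ 1ᴹ ≋ X
*ℚ-identityʳ X i j = sumℚ-1ᴹʳ j (X i)

*ℚ-distribˡ-- : ∀ {n k m} (X : Mat ℚ n k) (Y Z : Mat ℚ k m) →
  X *ℚ (Y -ᴹ Z) ≋ X *ℚ Y -ᴹ X *ℚ Z
*ℚ-distribˡ-- X Y Z i j =
  trans (sumℚ-cong (λ l → x[y-z]≈xy-xz (X i l) (Y l j) (Z l j)))
        (sumℚ-- (λ l → X i l * Y l j) (λ l → X i l * Z l j))

*ℚ-⊗ : ∀ {n k m} (X : Mat ℚ n k) (x : Fin k → ℚ) (y : Fin m → ℚ) →
  X *ℚ (x ⊗ y) ≋ (λ i → X i · x) ⊗ y
*ℚ-⊗ X x y i j = ·-*ʳ (X i) x (y j)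

*ℚ-complement : ∀ {n k} (X : Mat ℚ n k) (Y : Mat ℚ k k) → X *ℚ (1ᴹ -ᴹ Y) ≋ X -ᴹ X *ℚ Y
*ℚ-complement X Y i j =
  trans (*ℚ-distribˡ-- X 1ᴹ Y i j) (cong (_- (X *ℚ Y) i j) (*ℚ-identityʳ X i j))

IsRightInverse : ∀ {k m} → Mat ℚ k m → Mat ℚ m k → Set
IsRightInverse W P = W *ℚ P ≋ 1ᴹ

rightInverse-cancel : ∀ {n k m} {A : Mat ℚ n m} (U : Mat ℚ n k) (W : Mat ℚ k m) {P : Mat ℚ m k} →
  U *ℚ W ≋ A → IsRightInverse W P → U ≋ A *ℚ P
rightInverse-cancel {A = A} U W {P} UW≋A WP≋1 i j = begin
  U i j                ≡⟨ sym (*ℚ-identityʳ U i j) ⟩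
  (U *ℚ 1ᴹ) i j        ≡⟨ sym (*ℚ-congˡ U WP≋1 i j) ⟩
  (U *ℚ (W *ℚ P)) i j  ≡⟨ sym (*ℚ-assoc U W P i j) ⟩
  ((U *ℚ W) *ℚ P) i j  ≡⟨ *ℚ-congʳ P UW≋A i j ⟩
  (A *ℚ P) i j         ∎

rightInverse⇒annihilates : ∀ {k m} (W : Mat ℚ k m) (P : Mat ℚ m k) →
  IsRightInverse W P → W *ℚ (1ᴹ -ᴹ P *ℚ W) ≋ 0ᴹ
rightInverse⇒annihilates W P WP≋1 i j = begin
  (W *ℚ (1ᴹ -ᴹ P *ℚ W)) i j    ≡⟨ *ℚ-complement W (P *ℚ W) i j ⟩
  W i j - (W *ℚ (P *ℚ W)) i j  ≡⟨ cong (_-_ (W i j)) (sym (*ℚ-assoc W P W i j)) ⟩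
  W i j - ((W *ℚ P) *ℚ W) i j  ≡⟨ cong (_-_ (W i j)) (*ℚ-congʳ W WP≋1 i j) ⟩
  W i j - (1ᴹ *ℚ W) i j        ≡⟨ cong (_-_ (W i j)) (*ℚ-identityˡ W i j) ⟩
  W i j - W i j                ≡⟨ +-inverseʳ (W i j) ⟩
  0ℚ                           ∎

annihilated⇒factors : ∀ {n k m} (W : Mat ℚ n m) (P : Mat ℚ m k) (V : Mat ℚ k m) →
  W *ℚ (1ᴹ -ᴹ P *ℚ V) ≋ 0ᴹ → W ≋ (W *ℚ P) *ℚ V
annihilated⇒factors W P V W⊥ i j = begin
  W i j                ≡⟨ x∙y⁻¹≈ε⇒x≈y (W i j) ((W *ℚ (P *ℚ V)) i j)
                            (trans (sym (*ℚ-complement W (P *ℚ V) i j)) (W⊥ i j)) ⟩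
  (W *ℚ (P *ℚ V)) i j  ≡⟨ sym (*ℚ-assoc W P V i j) ⟩
  ((W *ℚ P) *ℚ V) i j  ∎

ℚFactor-consRow : ∀ {j k m} (W : Mat ℚ (suc k) m) → ℚFactor (W ∘ suc) j → ℚFactor W (suc j)
ℚFactor-consRow {j} W (Y , Z , YZ≋W′) = Y⁺ , Z⁺ , Y⁺Z⁺≋W
  where
  Y⁺ : Mat ℚ _ (suc j)
  Y⁺ zero             = 1ᴹ zero
  Y⁺ (suc a) zero     = 0ℚ
  Y⁺ (suc a) (suc b)  = Y a b
  Z⁺ : Mat ℚ (suc j) _
  Z⁺ zero    = W zero
  Z⁺ (suc b) = Z b
  Y⁺Z⁺≋W : Y⁺ *ℚ Z⁺ ≋ W
  Y⁺Z⁺≋W zero    c = sumℚ-1ᴹˡ zero (λ l → Z⁺ l c)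
  Y⁺Z⁺≋W (suc a) c = trans (cong₂ _+_ (*-zeroˡ (W zero c)) (YZ≋W′ a c)) (+-identityˡ _)

consCol : ∀ {k m} → (Fin m → ℚ) → Mat ℚ m k → Mat ℚ m (suc k)
consCol q P l zero    = q l
consCol q P l (suc b) = P l b

-- As W q = e₀, subtracting q ⊗ c, with c the first row of W P, clears that row of W P and
-- leaves the others.
rightInverse-cons : ∀ {k m} (W : Mat ℚ (suc k) m) (P : Mat ℚ m k) (q : Fin m → ℚ) →
  IsRightInverse (W ∘ suc) P → (∀ a → W a · q ≡ 1ᴹ a zero) →
  IsRightInverse W (consCol q (P -ᴹ q ⊗ (W *ℚ P) zero))
rightInverse-cons W P q W′P≋1 Wq≡e₀ a zero    = Wq≡e₀ a
rightInverse-cons W P q W′P≋1 Wq≡e₀ a (suc b) = begin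
  (W *ℚ (P -ᴹ q ⊗ c)) a b             ≡⟨ *ℚ-distribˡ-- W P (q ⊗ c) a b ⟩
  (W *ℚ P) a b - (W *ℚ (q ⊗ c)) a b   ≡⟨ cong (_-_ ((W *ℚ P) a b)) (*ℚ-⊗ W q c a b) ⟩
  (W *ℚ P) a b - (W a · q) * c b      ≡⟨ cong (λ z → (W *ℚ P) a b - z * c b) (Wq≡e₀ a) ⟩
  (W *ℚ P) a b - 1ᴹ a zero * c b      ≡⟨ clearFirstRow a ⟩
  1ᴹ a (suc b)                        ∎
  where
  c : Fin _ → ℚ
  c = (W *ℚ P) zero
  clearFirstRow : ∀ a → (W *ℚ P) a b - 1ᴹ a zero * c b ≡ 1ᴹ a (suc b)
  clearFirstRow zero    = trans (cong (_-_ (c b)) (*-identityˡ (c b))) (+-inverseʳ (c b))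
  clearFirstRow (suc a) =
    trans (cong (_-_ ((W *ℚ P) (suc a) b)) (*-zeroˡ (c b))) (trans (+-identityʳ _) (W′P≋1 a b))

pivot⇒e₀-preimage : ∀ {k m p} (W : Mat ℚ (suc k) m) (Q : Mat ℚ m p) (j : Fin p) →
  (W ∘ suc) *ℚ Q ≋ 0ᴹ → ¬ (W *ℚ Q) zero j ≡ 0ℚ → ∃ λ q → ∀ a → W a · q ≡ 1ᴹ a zero
pivot⇒e₀-preimage W Q j W′Q≋0 pivot≢0 = (λ l → Q l j * 1/ pivot) , λ a →
  trans (·-*ʳ (W a) (λ l → Q l j) (1/ pivot)) (normalise a)
  where
  pivot : ℚ
  pivot = (W *ℚ Q) zero j
  instance
    pivot-nonZero : NonZero pivot
    pivot-nonZero = ≢-nonZero pivot≢0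
  normalise : ∀ a → (W *ℚ Q) a j * 1/ pivot ≡ 1ᴹ a zero
  normalise zero    = *-inverseʳ pivot
  normalise (suc a) = trans (cong (_* 1/ pivot) (W′Q≋0 a j)) (*-zeroˡ (1/ pivot))

-- Π = 1ᴹ - P W′ projects onto the kernel of the lower rows W′. Either the first row of W Π
-- vanishes, and then W = (W P) W′ factors through k rows, or one of its entries is a pivot from
-- which the new first column of a right inverse is built.
rightInverse-extend : ∀ {k m} (W : Mat ℚ (suc k) m) (P : Mat ℚ m k) →
  IsRightInverse (W ∘ suc) P → ∃ (IsRightInverse W) ⊎ ℚFactor W k
rightInverse-extend W P W′P≋1 = extend (all? (λ j → (W *ℚ Π) zero j ≟ 0ℚ))
  where
  Π : Mat ℚ _ _
  Π = 1ᴹ -ᴹ P *ℚ (W ∘ suc)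
  W′Π≋0 : (W ∘ suc) *ℚ Π ≋ 0ᴹ
  W′Π≋0 = rightInverse⇒annihilates (W ∘ suc) P W′P≋1
  extend : Dec (∀ j → (W *ℚ Π) zero j ≡ 0ℚ) → ∃ (IsRightInverse W) ⊎ ℚFactor W _
  extend (yes top≡0) =
    inj₂ (W *ℚ P , W ∘ suc , λ i j → sym (annihilated⇒factors W P (W ∘ suc) WΠ≋0 i j))
    where
    WΠ≋0 : W *ℚ Π ≋ 0ᴹ
    WΠ≋0 zero    = top≡0
    WΠ≋0 (suc a) = W′Π≋0 a
  extend (no top≢0) =
    let j , pivot≢0 = ¬∀⟶∃¬ _ _ (λ j → (W *ℚ Π) zero j ≟ 0ℚ) top≢0
        q , Wq≡e₀   = pivot⇒e₀-preimage W Π j W′Π≋0 pivot≢0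
    in inj₁ (_ , rightInverse-cons W P q W′P≋1 Wq≡e₀)

rightInverse⊎smallerFactor : ∀ k {m} (W : Mat ℚ k m) →
  ∃ (IsRightInverse W) ⊎ ∃[ j ] j < k × ℚFactor W j
rightInverse⊎smallerFactor zero    W = inj₁ ((λ _ ()) , λ ())
rightInverse⊎smallerFactor (suc k) W with rightInverse⊎smallerFactor k (W ∘ suc)
... | inj₁ (P , W′P≋1)     = Sum.map₂ (λ W≋YZ → k , n<1+n k , W≋YZ) (rightInverse-extend W P W′P≋1)
... | inj₂ (j , j<k , W′≋YZ) = inj₂ (suc j , s≤s j<k , ℚFactor-consRow W W′≋YZ)

minimalFactor⇒rightInverse : ∀ {n k m} {A : Mat ℚ n m} (U : Mat ℚ n k) (W : Mat ℚ k m) →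
  U *ℚ W ≋ A → (∀ j → j < k → ¬ ℚFactor A j) → ∃ (IsRightInverse W)
minimalFactor⇒rightInverse {k = k} U W UW≋A minimal with rightInverse⊎smallerFactor k W
... | inj₁ P = P
... | inj₂ (j , j<k , Y , Z , YZ≋W) = ⊥-elim (minimal j j<k (U *ℚ Y , Z , UYZ≋A))
  where
  UYZ≋A : (U *ℚ Y) *ℚ Z ≋ _
  UYZ≋A i c = trans (*ℚ-assoc U Y Z i c) (trans (*ℚ-congˡ U YZ≋W i c) (UW≋A i c))

b2ℕ×1 : ∀ b → b2ℕ b ×ℚ 1ℚ ≡ b2ℚ b
b2ℕ×1 false = refl
b2ℕ×1 true  = refl

sumℕ×1 : ∀ {k} (f : Fin k → ℕ) → sumℕ f ×ℚ 1ℚ ≡ sumℚ (λ i → f i ×ℚ 1ℚ)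
sumℕ×1 {zero}  f = refl
sumℕ×1 {suc k} f =
  trans (×-homo-+ 1ℚ (f zero) (sumℕ (f ∘ suc))) (cong (f zero ×ℚ 1ℚ +_) (sumℕ×1 (f ∘ suc)))

binFactor⇒ℚFactor : ∀ {n m k} (A : BinMat n m) → BinFactor A k → ℚFactor (toℚMat A) k
binFactor⇒ℚFactor A (U , V , UV≡A) = toℚMat U , toℚMat V , λ i j → begin
  sumℚ (λ l → b2ℚ (U i l) * b2ℚ (V l j))
    ≡⟨ sumℚ-cong (λ l → sym (entry (U i l) (V l j))) ⟩
  sumℚ (λ l → (b2ℕ (U i l) ℕ.* b2ℕ (V l j)) ×ℚ 1ℚ)
    ≡⟨ sym (sumℕ×1 (λ l → b2ℕ (U i l) ℕ.* b2ℕ (V l j))) ⟩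
  sumℕ (λ l → b2ℕ (U i l) ℕ.* b2ℕ (V l j)) ×ℚ 1ℚ
    ≡⟨ cong (_×ℚ 1ℚ) (UV≡A i j) ⟩
  b2ℕ (A i j) ×ℚ 1ℚ
    ≡⟨ b2ℕ×1 (A i j) ⟩
  b2ℚ (A i j) ∎
  where
  entry : ∀ u v → (b2ℕ u ℕ.* b2ℕ v) ×ℚ 1ℚ ≡ b2ℚ u * b2ℚ v
  entry u v = trans (×1-homo-* (b2ℕ u) (b2ℕ v)) (cong₂ _*_ (b2ℕ×1 u) (b2ℕ×1 v))

appendCols-↑ˡ : ∀ {n m t} (A : BinMat n m) (xs : Fin t → BinCol n) i c →
  appendCols A xs i (c ↑ˡ t) ≡ A i c
appendCols-↑ˡ {m = m} {t} A xs i c = cong [ A i , (λ s → xs s i) ]′ (splitAt-↑ˡ m c t)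

appendCols-↑ʳ : ∀ {n m t} (A : BinMat n m) (xs : Fin t → BinCol n) i s →
  appendCols A xs i (m ↑ʳ s) ≡ xs s i
appendCols-↑ʳ {m = m} {t} A xs i s = cong [ A i , (λ s → xs s i) ]′ (splitAt-↑ʳ m t s)

ℚFactor-appendCols⇒ℚFactor : ∀ {n m t k} (A : BinMat n m) (xs : Fin t → BinCol n) →
  ℚFactor (toℚMat (appendCols A xs)) k → ℚFactor (toℚMat A) k
ℚFactor-appendCols⇒ℚFactor {t = t} A xs (X , Y , XY≋) =
  X , (λ l c → Y l (c ↑ˡ t)) , λ i c → trans (XY≋ i (c ↑ˡ t)) (cong b2ℚ (appendCols-↑ˡ A xs i c))

appendCols-ℚFactor : ∀ {n m t r} (A : BinMat n m) (xs : Fin t → BinCol n)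
  (U : Mat ℚ n r) (V : Mat ℚ r m) (cs : Fin t → Fin r → ℚ) →
  U *ℚ V ≋ toℚMat A → (∀ s i → U i · cs s ≡ b2ℚ (xs s i)) →
  ℚFactor (toℚMat (appendCols A xs)) r
appendCols-ℚFactor {m = m} {t} A xs U V cs UV≋A Ucs≡xs = U , V⁺ , λ i j → column i (splitAt m j)
  where
  V⁺ : Mat ℚ _ (m ℕ.+ t)
  V⁺ b j = [ V b , (λ s → cs s b) ]′ (splitAt m j)
  column : ∀ i (e : Fin m ⊎ Fin t) →
    U i · (λ b → [ V b , (λ s → cs s b) ]′ e) ≡ b2ℚ ([ A i , (λ s → xs s i) ]′ e)
  column i (inj₁ c) = UV≋A i c
  column i (inj₂ s) = Ucs≡xs s i

minimalFactor⇒leftFactorsThrough : ∀ {n k k′ m} {A : Mat ℚ n m}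
  (U : Mat ℚ n k) (V : Mat ℚ k m) (U′ : Mat ℚ n k′) (W : Mat ℚ k′ m) →
  U *ℚ V ≋ A → U′ *ℚ W ≋ A → (∀ j → j < k′ → ¬ ℚFactor A j) → ∃ λ C → U′ ≋ U *ℚ C
minimalFactor⇒leftFactorsThrough {A = A} U V U′ W UV≋A U′W≋A minimal =
  let P , WP≋1 = minimalFactor⇒rightInverse U′ W U′W≋A minimal
  in V *ℚ P , λ i b → begin
    U′ i b               ≡⟨ rightInverse-cancel U′ W U′W≋A WP≋1 i b ⟩
    (A *ℚ P) i b         ≡⟨ sym (*ℚ-congʳ P UV≋A i b) ⟩
    ((U *ℚ V) *ℚ P) i b  ≡⟨ *ℚ-assoc U V P i b ⟩
    (U *ℚ (V *ℚ P)) i b  ∎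

appendCol-inColumnSpan : ∀ {n m r} (A : BinMat n m) (x : BinCol n) (U : Mat ℚ n r) (V : Mat ℚ r m) →
  U *ℚ V ≋ toℚMat A → (∀ k → k < r → ¬ ℚFactor (toℚMat A) k) →
  ℚFactor (toℚMat (appendCol A x)) r → ∃ λ c → ∀ i → U i · c ≡ b2ℚ (x i)
appendCol-inColumnSpan {m = m} A x U V UV≋A minimal (U′ , W⁺ , U′W⁺≋A⁺) =
  let C , U′≋UC = minimalFactor⇒leftFactorsThrough U V U′ W UV≋A U′W≋A minimal
  in (λ b → (C *ℚ W⁺) b xCol) , λ i → begin
    (U *ℚ (C *ℚ W⁺)) i xCol     ≡⟨ sym (*ℚ-assoc U C W⁺ i xCol) ⟩
    ((U *ℚ C) *ℚ W⁺) i xCol     ≡⟨ sym (*ℚ-congʳ W⁺ U′≋UC i xCol) ⟩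
    (U′ *ℚ W⁺) i xCol           ≡⟨ U′W⁺≋A⁺ i xCol ⟩
    b2ℚ (appendCol A x i xCol)  ≡⟨ cong b2ℚ (appendCols-↑ʳ A (λ _ → x) i zero) ⟩
    b2ℚ (x i)                   ∎
  where
  xCol : Fin (m ℕ.+ 1)
  xCol = m ↑ʳ zero
  W : Mat ℚ _ m
  W l c = W⁺ l (c ↑ˡ 1)
  U′W≋A : U′ *ℚ W ≋ toℚMat A
  U′W≋A i c = trans (U′W⁺≋A⁺ i (c ↑ˡ 1)) (cong b2ℚ (appendCols-↑ˡ A (λ _ → x) i c))

mainTheorem18 : ∀ {n m t} (A : BinMat n m) (xs : Fin t → BinCol n) (r : ℕ) →
    RealRankIs A r → BinRankIs A r →
    (∀ i → BinRankIs (appendCol A (xs i)) r) →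
    RealRankIs (appendCols A xs) r
mainTheorem18 A xs r ((U , V , UV≋A) , minimal) _ rank[A|xs] =
  appendCols-ℚFactor A xs U V (proj₁ ∘ xs∈span) UV≋A (proj₂ ∘ xs∈span) ,
  λ k k<r → minimal k k<r ∘ ℚFactor-appendCols⇒ℚFactor A xs
  where
  xs∈span : ∀ s → ∃ λ c → ∀ i → U i · c ≡ b2ℚ (xs s i)
  xs∈span s = appendCol-inColumnSpan A (xs s) U V UV≋A minimal
    (binFactor⇒ℚFactor (appendCol A (xs s)) (proj₁ (rank[A|xs] s)))
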